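{- Let $m,j,r\ge0$ and $p\ge1$ be integers and let $r_1,\ldots,r_m$ be nonnegative integers with $r_1+\cdots+r_m=r$ and $r_1+2r_2+\cdots+mr_m=m$. Then the number of $B\in\mathscr{B}_{m,p}^{j,r}$ having exactly $r_i$ entries equal to $i$ for each $i=1,\ldots,m$ is $$\binom{r}{r_1,r_2,\ldots,r_m}\sum_{i=0}^{\lfloor r/(j+1)\rfloor}(-1)^i\binom{p}{i}\binom{p+r-i(j+1)-1}{p-1}.$$
   Context: A $p\times j$ bipartite matrix composition of a nonnegative integer $m$ is a $p\times j$ matrix with nonnegative integer entries summing to $m$ such that each row has the form $(a_1,\ldots,a_i,0,\ldots,0)$ for some $0\le i\le j$ with $a_1,\ldots,a_i\ge1$. $\mathscr{B}_{m,p}^{j,r}$ is the set of $p\times j$ bipartite matrix compositions of $m$ with exactly $r$ nonzero entries. -}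

module Defs where

open import Data.Nat using (ℕ; zero; suc; _+_; _*_; _∸_; _/_; _!; NonZero)
open import Data.Nat.Properties using (_!≢0; m*n≢0)
open import Data.Nat.Combinatorics using (_C_)
open import Data.Bool using (Bool; true; false; _∧_; if_then_else_)
open import Data.Vec using (Vec; []; _∷_; map; foldr; allFin)
open import Data.Fin using (Fin; toℕ)
open import Data.List using (List; upTo)
import Data.List as L
open import Data.Integer using (ℤ; +_; -[1+_]) renaming (_*_ to _*ℤ_; _^_ to _^ℤ_)
import Data.Integer as Z
open import Data.Nat using (_≡ᵇ_)

Matrix : ℕ → ℕ → Set
Matrix p j = Vec (Vec ℕ j) p

allZero : ∀ {n} → Vec ℕ n → Bool
allZero [] = true
allZero (zero ∷ xs) = allZero xs
allZero (suc _ ∷ xs) = false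

-- a row has the form (a_1,…,a_i,0,…,0) with a_1,…,a_i ≥ 1 (0 ≤ i ≤ j)
rowForm : ∀ {n} → Vec ℕ n → Bool
rowForm [] = true
rowForm (zero ∷ xs) = allZero xs
rowForm (suc _ ∷ xs) = rowForm xs

allRowsForm : ∀ {p j} → Matrix p j → Bool
allRowsForm [] = true
allRowsForm (row ∷ rows) = rowForm row ∧ allRowsForm rows

vsum : ∀ {n} → Vec ℕ n → ℕ
vsum = foldr _ _+_ 0

entrySum : ∀ {p j} → Matrix p j → ℕ
entrySum B = vsum (map vsum B)

countRow : ∀ {n} → (ℕ → Bool) → Vec ℕ n → ℕ
countRow t [] = 0
countRow t (x ∷ xs) = (if t x then 1 else 0) + countRow t xs

countMat : ∀ {p j} → (ℕ → Bool) → Matrix p j → ℕ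
countMat t B = vsum (map (countRow t) B)

isNonzero : ℕ → Bool
isNonzero zero = false
isNonzero (suc _) = true

nonzeroCount : ∀ {p j} → Matrix p j → ℕ
nonzeroCount = countMat isNonzero

countEq : ∀ {p j} → ℕ → Matrix p j → ℕ
countEq a = countMat (λ x → x ≡ᵇ a)

isBMC : ∀ {p j} → ℕ → Matrix p j → Bool
isBMC m B = allRowsForm B ∧ (entrySum B ≡ᵇ m)

-- entry-type vector: the k-th component (k = 0,…,m-1) is the number of
-- entries equal to k+1
entryTypes : ∀ {p j} (m : ℕ) → Matrix p j → Vec ℕ m
entryTypes m B = map (λ k → countEq (suc (toℕ k)) B) (allFin m)

factProd : ∀ {n} → Vec ℕ n → ℕ
factProd [] = 1
factProd (x ∷ xs) = x ! * factProd xs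

factProd≢0 : ∀ {n} (xs : Vec ℕ n) → NonZero (factProd xs)
factProd≢0 [] = _
factProd≢0 (x ∷ xs) = m*n≢0 (x !) (factProd xs) {{x !≢0}} {{factProd≢0 xs}}

multinomial : ∀ {n} → ℕ → Vec ℕ n → ℕ
multinomial r rs = (r ! / factProd rs) {{factProd≢0 rs}}

altSum : (p j r : ℕ) → ℤ
altSum p j r = L.foldr Z._+_ (+ 0)
  (L.map (λ i → (-[1+ 0 ] ^ℤ i) *ℤ + ((p C i) * ((p + r ∸ i * suc j ∸ 1) C (p ∸ 1))))
         (upTo (suc (r / suc j))))

module Submission where

-- A p × j matrix whose rows have the form (a₁, …, aᵢ, 0, …, 0) with all
-- aₗ ≥ 1 is the same thing as its vector ks ∈ {0, …, j}^p of row lengths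
-- together with the word w of its nonzero entries, read row by row
-- (MatrixEncoding).  Under this encoding the hypotheses say exactly that ks
-- is a composition of r into p parts bounded by j and that w, a word over
-- {1, …, m}, has letter multiplicities rs (LetterEncoding).  So the counted
-- set is in bijection with a product of two sets:
--   * words with multiplicities rs, built by interleaving binary words,
--     number r!/(r₁! ⋯ r_m!) (WordCounting);
--   * compositions with parts at most j have generating function
--     ((1 - x^{j+1})/(1 - x))^p; expanding (1 - x^{j+1})^p by the binomial
--     theorem and (1 - x)^{-p} by C(p - 1 + t, p - 1) gives the alternating
--     sum (PowerSeries, BoundedCompositions).

open import Defs
open import Data.Nat using (ℕ)


module Bijections where

  open import Data.Nat using (ℕ; zero; suc; _+_; _*_)
  open import Data.Fin using (Fin; zero; suc)
  open import Data.Vec using (Vec; _∷_)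
  import Data.Fin.Properties as FinP
  open import Data.Product using (Σ; _×_; _,_; proj₁; proj₂)
  open import Data.Sum using (_⊎_; inj₁; inj₂)
  open import Data.Empty using (⊥; ⊥-elim)
  open import Data.Sum.Function.Propositional using (_⊎-↔_)
  open import Data.Product.Function.Dependent.Propositional using (Σ-↔)
  open import Function.Bundles using (_↔_; mk↔ₛ′)
  open import Function.Properties.Inverse using (↔-refl; ↔-sym; ↔-trans)
  open import Relation.Binary.PropositionalEquality using (_≡_; refl; sym; cong; cong₂)
  open import Relation.Unary using (Irrelevant)
  import Relation.Nullary as Nullary
  import Data.Nat.Properties as ℕP
  import Data.Vec.Properties as VecP
  open import Axiom.UniquenessOfIdentityProofs using (module Decidable⇒UIP)

  private variable
    A B : Set

  ≡Vec-irrelevant : {n : ℕ} {xs ys : Vec ℕ n} → Nullary.Irrelevant (xs ≡ ys)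
  ≡Vec-irrelevant = Decidable⇒UIP.≡-irrelevant (VecP.≡-dec ℕP._≟_)

  ×-irrelevant : Nullary.Irrelevant A → Nullary.Irrelevant B → Nullary.Irrelevant (A × B)
  ×-irrelevant irrA irrB (a , b) (a′ , b′) = cong₂ _,_ (irrA a a′) (irrB b b′)

  ≡×≡-irrelevant : {a b c d : ℕ} → Nullary.Irrelevant (a ≡ b × c ≡ d)
  ≡×≡-irrelevant = ×-irrelevant ℕP.≡-irrelevant ℕP.≡-irrelevant

  infixr 2 _⟫_
  _⟫_ : {C : Set} → A ↔ B → B ↔ C → A ↔ C
  _⟫_ = ↔-trans

  Σ-≡-irrelevant : {P : A → Set} → Irrelevant P →
    {a a′ : A} → a ≡ a′ → (p : P a) (p′ : P a′) → _≡_ {A = Σ A P} (a , p) (a′ , p′)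
  Σ-≡-irrelevant irr refl p p′ = cong (_ ,_) (irr p p′)

  -- Only the forward map may use the proof of the predicate (e.g. to turn
  -- numbers into letters of a bounded alphabet).
  Σ-↔-restrict : {P : A → Set} {Q : B → Set}
    (f : (a : A) → P a → B) (g : B → A)
    (f-Q : ∀ a p → Q (f a p)) (g-P : ∀ b → Q b → P (g b))
    (g∘f : ∀ a p → g (f a p) ≡ a) (f∘g : ∀ b q → f (g b) (g-P b q) ≡ b) →
    Irrelevant P → Irrelevant Q → Σ A P ↔ Σ B Q
  Σ-↔-restrict f g f-Q g-P g∘f f∘g irrP irrQ = mk↔ₛ′
    (λ { (a , p) → f a p , f-Q a p })
    (λ { (b , q) → g b , g-P b q })
    (λ { (b , q) → Σ-≡-irrelevant irrQ (f∘g b q) _ _ })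
    (λ { (a , p) → Σ-≡-irrelevant irrP (g∘f a p) _ _ })

  Σ-↔-pred : {P Q : A → Set} → (∀ {a} → P a → Q a) → (∀ {a} → Q a → P a) →
    Irrelevant P → Irrelevant Q → Σ A P ↔ Σ A Q
  Σ-↔-pred P⇒Q Q⇒P = Σ-↔-restrict (λ a _ → a) (λ a → a) (λ _ → P⇒Q) (λ _ → Q⇒P) (λ _ _ → refl) (λ _ _ → refl)

  empty↔Fin0 : (A → ⊥) → A ↔ Fin 0
  empty↔Fin0 ¬a = mk↔ₛ′ (λ a → ⊥-elim (¬a a)) (λ ()) (λ ()) (λ a → ⊥-elim (¬a a))

  singleton↔Fin1 : (a₀ : A) → (∀ a → a ≡ a₀) → A ↔ Fin 1
  singleton↔Fin1 a₀ unique = mk↔ₛ′ (λ _ → zero) (λ _ → a₀) (λ { zero → refl }) (λ a → sym (unique a))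

  ⊎↔Fin+ : {m n : ℕ} → (Fin m ⊎ Fin n) ↔ Fin (m + n)
  ⊎↔Fin+ = ↔-sym FinP.+↔⊎

  ×↔Fin* : {m n : ℕ} → (Fin m × Fin n) ↔ Fin (m * n)
  ×↔Fin* = ↔-sym FinP.*↔×

  sumFin : (n : ℕ) → (Fin n → ℕ) → ℕ
  sumFin zero    h = 0
  sumFin (suc n) h = h zero + sumFin n (λ k → h (suc k))

  Σ-Fin-suc : {n : ℕ} {F : Fin (suc n) → Set} → Σ (Fin (suc n)) F ↔ (F zero ⊎ Σ (Fin n) (λ k → F (suc k)))
  Σ-Fin-suc = mk↔ₛ′
    (λ { (zero , x) → inj₁ x ; (suc k , x) → inj₂ (k , x) })
    (λ { (inj₁ x) → zero , x ; (inj₂ (k , x)) → suc k , x })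
    (λ { (inj₁ x) → refl ; (inj₂ (k , x)) → refl })
    (λ { (zero , x) → refl ; (suc k , x) → refl })

  ΣFin↔Fin-sum : (n : ℕ) (h : Fin n → ℕ) → Σ (Fin n) (λ k → Fin (h k)) ↔ Fin (sumFin n h)
  ΣFin↔Fin-sum zero    h = empty↔Fin0 (λ ())
  ΣFin↔Fin-sum (suc n) h = Σ-Fin-suc ⟫ (↔-refl ⊎-↔ ΣFin↔Fin-sum n (λ k → h (suc k))) ⟫ ⊎↔Fin+

  Σ-↔-fibres : {F G : A → Set} → (∀ a → F a ↔ G a) → Σ A F ↔ Σ A G
  Σ-↔-fibres e = Σ-↔ ↔-refl (e _)

  Σ-×-split : {P : A → Set} {Q : B → Set} →
    Σ (A × B) (λ ab → P (proj₁ ab) × Q (proj₂ ab)) ↔ (Σ A P × Σ B Q)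
  Σ-×-split = mk↔ₛ′ (λ { ((a , b) , (p , q)) → (a , p) , (b , q) }) (λ { ((a , p) , (b , q)) → (a , b) , (p , q) })
    (λ _ → refl) (λ _ → refl)

  Σ-Vec-suc : {p : ℕ} {P : Vec A (suc p) → Set} → Σ (Vec A (suc p)) P ↔ Σ A (λ a → Σ (Vec A p) (λ v → P (a ∷ v)))
  Σ-Vec-suc = mk↔ₛ′ (λ { (a ∷ v , x) → a , (v , x) }) (λ { (a , (v , x)) → a ∷ v , x })
    (λ _ → refl) (λ { (a ∷ v , x) → refl })


module WordCounting where

  open Bijections
  open import Data.Nat using (ℕ; zero; suc; _+_; _*_; _!; _/_)
  import Data.Nat.Properties as ℕP
  open import Data.Nat.DivMod using (m*n/n≡m)
  open import Data.Nat.Tactic.RingSolver using (solve-∀)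
  open import Data.Bool using (Bool; true; false)
  open import Data.Fin using (Fin; zero; suc)
  open import Data.List using (List; []; _∷_; length)
  open import Data.Vec using (Vec; []; _∷_)
  import Data.Vec.Properties as VecP
  open import Data.Product using (Σ; _×_; _,_; proj₁; proj₂)
  open import Data.Sum using (_⊎_; inj₁; inj₂)
  open import Data.Sum.Function.Propositional using (_⊎-↔_)
  open import Data.Product.Function.NonDependent.Propositional using (_×-↔_)
  open import Function.Bundles using (_↔_; mk↔ₛ′)
  open import Relation.Binary.PropositionalEquality

  trues falses : List Bool → ℕ
  trues []          = 0
  trues (true ∷ b)  = suc (trues b)
  trues (false ∷ b) = trues b
  falses []          = 0
  falses (true ∷ b)  = falses b
  falses (false ∷ b) = suc (falses b)

  BinWord : ℕ → ℕ → Set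
  BinWord k s = Σ (List Bool) (λ b → trues b ≡ k × falses b ≡ s)

  mutual
    binWords : ℕ → ℕ → ℕ
    binWords k s = emptyWords k s + (startingTrue k s + startingFalse k s)

    emptyWords : ℕ → ℕ → ℕ
    emptyWords zero zero = 1
    emptyWords _    _    = 0

    startingTrue : ℕ → ℕ → ℕ
    startingTrue zero    s = 0
    startingTrue (suc k) s = binWords k s

    startingFalse : ℕ → ℕ → ℕ
    startingFalse k zero    = 0
    startingFalse k (suc s) = binWords k s

  Σ-List-Bool : {P : List Bool → Set} →
    Σ (List Bool) P ↔ (P [] ⊎ (Σ (List Bool) (λ b → P (true ∷ b)) ⊎ Σ (List Bool) (λ b → P (false ∷ b))))
  Σ-List-Bool = mk↔ₛ′
    (λ { ([] , x) → inj₁ x ; (true ∷ b , x) → inj₂ (inj₁ (b , x)) ; (false ∷ b , x) → inj₂ (inj₂ (b , x)) })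
    (λ { (inj₁ x) → [] , x ; (inj₂ (inj₁ (b , x))) → true ∷ b , x ; (inj₂ (inj₂ (b , x))) → false ∷ b , x })
    (λ { (inj₁ x) → refl ; (inj₂ (inj₁ _)) → refl ; (inj₂ (inj₂ _)) → refl })
    (λ { ([] , x) → refl ; (true ∷ b , x) → refl ; (false ∷ b , x) → refl })

  mutual
    BinWord↔Fin : ∀ k s → BinWord k s ↔ Fin (binWords k s)
    BinWord↔Fin k s = Σ-List-Bool ⟫ (emptyWord↔Fin k s ⊎-↔ ((trueFirst↔Fin k s ⊎-↔ falseFirst↔Fin k s) ⟫ ⊎↔Fin+)) ⟫ ⊎↔Fin+

    emptyWord↔Fin : ∀ k s → (0 ≡ k × 0 ≡ s) ↔ Fin (emptyWords k s)
    emptyWord↔Fin zero    zero    = singleton↔Fin1 (refl , refl) (λ { (refl , refl) → refl })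
    emptyWord↔Fin zero    (suc s) = empty↔Fin0 (λ ())
    emptyWord↔Fin (suc k) s       = empty↔Fin0 (λ ())

    trueFirst↔Fin : ∀ k s → Σ (List Bool) (λ b → suc (trues b) ≡ k × falses b ≡ s) ↔ Fin (startingTrue k s)
    trueFirst↔Fin zero    s = empty↔Fin0 (λ ())
    trueFirst↔Fin (suc k) s =
      Σ-↔-pred (λ (e , f) → ℕP.suc-injective e , f) (λ (e , f) → cong suc e , f)
        ≡×≡-irrelevant ≡×≡-irrelevant
      ⟫ BinWord↔Fin k s

    falseFirst↔Fin : ∀ k s → Σ (List Bool) (λ b → trues b ≡ k × suc (falses b) ≡ s) ↔ Fin (startingFalse k s)
    falseFirst↔Fin k zero    = empty↔Fin0 (λ ())
    falseFirst↔Fin k (suc s) =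
      Σ-↔-pred (λ (e , f) → e , ℕP.suc-injective f) (λ (e , f) → e , cong suc f)
        ≡×≡-irrelevant ≡×≡-irrelevant
      ⟫ BinWord↔Fin k s

  -- binWords k s = (k + s)! / (k! s!), in multiplied-out form; by Pascal's rule.
  binWords-factorial : ∀ k s → binWords k s * (k ! * s !) ≡ (k + s) !
  binWords-factorial zero    zero    = refl
  binWords-factorial (suc k) zero    = begin
    (binWords k 0 + 0) * ((suc k * k !) * 1) ≡⟨ rearrange (binWords k 0) k (k !) ⟩
    suc k * (binWords k 0 * (k ! * 1))      ≡⟨ cong (suc k *_) (binWords-factorial k 0) ⟩
    suc k * (k + 0) !                       ≡⟨ cong (λ t → suc t * (k + 0) !) (ℕP.+-identityʳ k) ⟨
    (suc k + 0) !                           ∎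
    where
    open ≡-Reasoning
    rearrange : ∀ b k f → (b + 0) * ((suc k * f) * 1) ≡ suc k * (b * (f * 1))
    rearrange = solve-∀
  binWords-factorial zero    (suc s) = begin
    binWords 0 s * (1 * (suc s * s !)) ≡⟨ rearrange (binWords 0 s) s (s !) ⟩
    suc s * (binWords 0 s * (1 * s !)) ≡⟨ cong (suc s *_) (binWords-factorial 0 s) ⟩
    (suc s) !                          ∎
    where
    open ≡-Reasoning
    rearrange : ∀ b s f → b * (1 * (suc s * f)) ≡ suc s * (b * (1 * f))
    rearrange = solve-∀
  binWords-factorial (suc k) (suc s) = begin
    (binWords k (suc s) + binWords (suc k) s) * ((suc k * k !) * (suc s * s !))
      ≡⟨ rearrange (binWords k (suc s)) (binWords (suc k) s) k s (k !) (s !) ⟩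
    suc k * (binWords k (suc s) * (k ! * (suc s * s !))) + suc s * (binWords (suc k) s * ((suc k * k !) * s !))
      ≡⟨ cong₂ (λ x y → suc k * x + suc s * y) (binWords-factorial k (suc s))
           (trans (binWords-factorial (suc k) s) (cong _! (sym (ℕP.+-suc k s)))) ⟩
    suc k * (k + suc s) ! + suc s * (k + suc s) !
      ≡⟨ ℕP.*-distribʳ-+ ((k + suc s) !) (suc k) (suc s) ⟨
    (suc k + suc s) ! ∎
    where
    open ≡-Reasoning
    rearrange : ∀ a b k s x y → (a + b) * ((suc k * x) * (suc s * y))
      ≡ suc k * (a * (x * (suc s * y))) + suc s * (b * ((suc k * x) * y))
    rearrange = solve-∀

  module _ {m : ℕ} where
    zeroCount : List (Fin (suc m)) → ℕ
    zeroCount []          = 0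
    zeroCount (zero ∷ v)  = suc (zeroCount v)
    zeroCount (suc _ ∷ v) = zeroCount v

    lowerNonzero : List (Fin (suc m)) → List (Fin m)
    lowerNonzero []          = []
    lowerNonzero (zero ∷ v)  = lowerNonzero v
    lowerNonzero (suc y ∷ v) = y ∷ lowerNonzero v

    zeroPattern : List (Fin (suc m)) → List Bool
    zeroPattern []          = []
    zeroPattern (zero ∷ v)  = true ∷ zeroPattern v
    zeroPattern (suc _ ∷ v) = false ∷ zeroPattern v

    interleave : List Bool → List (Fin m) → List (Fin (suc m))
    interleave []          u       = []
    interleave (true ∷ b)  u       = zero ∷ interleave b u
    interleave (false ∷ b) []      = interleave b []
    interleave (false ∷ b) (y ∷ u) = suc y ∷ interleave b u

    interleave-split : (v : List (Fin (suc m))) → interleave (zeroPattern v) (lowerNonzero v) ≡ v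
    interleave-split []          = refl
    interleave-split (zero ∷ v)  = cong (zero ∷_) (interleave-split v)
    interleave-split (suc y ∷ v) = cong (suc y ∷_) (interleave-split v)

    zeroPattern-interleave : ∀ b (u : List (Fin m)) → falses b ≡ length u → zeroPattern (interleave b u) ≡ b
    zeroPattern-interleave []          []      e = refl
    zeroPattern-interleave (true ∷ b)  u       e = cong (true ∷_) (zeroPattern-interleave b u e)
    zeroPattern-interleave (false ∷ b) (y ∷ u) e = cong (false ∷_) (zeroPattern-interleave b u (ℕP.suc-injective e))

    lowerNonzero-interleave : ∀ b (u : List (Fin m)) → falses b ≡ length u → lowerNonzero (interleave b u) ≡ u
    lowerNonzero-interleave []          []      e = refl
    lowerNonzero-interleave (true ∷ b)  u       e = lowerNonzero-interleave b u e
    lowerNonzero-interleave (false ∷ b) (y ∷ u) e = cong (y ∷_) (lowerNonzero-interleave b u (ℕP.suc-injective e))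

    zeroCount-interleave : ∀ b (u : List (Fin m)) → zeroCount (interleave b u) ≡ trues b
    zeroCount-interleave []          u       = refl
    zeroCount-interleave (true ∷ b)  u       = cong suc (zeroCount-interleave b u)
    zeroCount-interleave (false ∷ b) []      = zeroCount-interleave b []
    zeroCount-interleave (false ∷ b) (y ∷ u) = zeroCount-interleave b u

    trues-zeroPattern : (v : List (Fin (suc m))) → trues (zeroPattern v) ≡ zeroCount v
    trues-zeroPattern []          = refl
    trues-zeroPattern (zero ∷ v)  = cong suc (trues-zeroPattern v)
    trues-zeroPattern (suc _ ∷ v) = trues-zeroPattern v

    falses-zeroPattern : (v : List (Fin (suc m))) → falses (zeroPattern v) ≡ length (lowerNonzero v)
    falses-zeroPattern []          = refl
    falses-zeroPattern (zero ∷ v)  = falses-zeroPattern v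
    falses-zeroPattern (suc _ ∷ v) = cong suc (falses-zeroPattern v)

    length-split : (v : List (Fin (suc m))) → length v ≡ zeroCount v + length (lowerNonzero v)
    length-split []          = refl
    length-split (zero ∷ v)  = cong suc (length-split v)
    length-split (suc _ ∷ v) = trans (cong suc (length-split v)) (sym (ℕP.+-suc (zeroCount v) _))

  -- Letter multiplicities of a word: entry k counts the letter k.
  content : {m : ℕ} → List (Fin m) → Vec ℕ m
  content {zero}  _ = []
  content {suc m} v = zeroCount v ∷ content (lowerNonzero v)

  length-content : {m : ℕ} (v : List (Fin m)) → length v ≡ vsum (content v)
  length-content {zero}  []  = refl
  length-content {suc m} v   = trans (length-split v) (cong (zeroCount v +_) (length-content (lowerNonzero v)))

  WordsWithContent : {m : ℕ} → Vec ℕ m → Set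
  WordsWithContent {m} rs = Σ (List (Fin m)) (λ v → content v ≡ rs)

  -- A word with content r ∷ rs is the interleaving of a binary word (the
  -- positions of the letter 0) with a word of content rs.
  WordsWithContent-split : {m : ℕ} (r : ℕ) (rs : Vec ℕ m) →
    WordsWithContent (r ∷ rs) ↔ (BinWord r (vsum rs) × WordsWithContent rs)
  WordsWithContent-split {m} r rs =
    Σ-↔-restrict (λ v _ → zeroPattern v , lowerNonzero v) (λ (b , u) → interleave b u)
      split-valid interleave-valid
      (λ v _ → interleave-split v)
      (λ (b , u) q → cong₂ _,_ (zeroPattern-interleave b u (lengths-match b u q)) (lowerNonzero-interleave b u (lengths-match b u q)))
      ≡Vec-irrelevant (×-irrelevant ≡×≡-irrelevant ≡Vec-irrelevant)
    ⟫ Σ-×-split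
    where
    Valid : List Bool × List (Fin m) → Set
    Valid (b , u) = (trues b ≡ r × falses b ≡ vsum rs) × content u ≡ rs

    lengths-match : ∀ b u → Valid (b , u) → falses b ≡ length u
    lengths-match b u ((_ , fb) , cu) = trans fb (trans (cong vsum (sym cu)) (sym (length-content u)))

    split-valid : ∀ v → content v ≡ r ∷ rs → Valid (zeroPattern v , lowerNonzero v)
    split-valid v cv with VecP.∷-injective cv
    ... | z , c = (trans (trues-zeroPattern v) z , trans (falses-zeroPattern v) (trans (length-content (lowerNonzero v)) (cong vsum c))) , c

    interleave-valid : ∀ bu → Valid bu → content (interleave (proj₁ bu) (proj₂ bu)) ≡ r ∷ rs
    interleave-valid (b , u) q@((tb , _) , cu) =
      cong₂ _∷_ (trans (zeroCount-interleave b u) tb) (trans (cong content (lowerNonzero-interleave b u (lengths-match b u q))) cu)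

  wordCount : {m : ℕ} → Vec ℕ m → ℕ
  wordCount []       = 1
  wordCount (r ∷ rs) = binWords r (vsum rs) * wordCount rs

  WordsWithContent↔Fin : {m : ℕ} (rs : Vec ℕ m) → WordsWithContent rs ↔ Fin (wordCount rs)
  WordsWithContent↔Fin []       = singleton↔Fin1 ([] , refl) (λ { ([] , refl) → refl ; ((() ∷ _) , _) })
  WordsWithContent↔Fin (r ∷ rs) = WordsWithContent-split r rs ⟫ (BinWord↔Fin r (vsum rs) ×-↔ WordsWithContent↔Fin rs) ⟫ ×↔Fin*

  factProd*wordCount : {m : ℕ} (rs : Vec ℕ m) → factProd rs * wordCount rs ≡ (vsum rs) !
  factProd*wordCount []       = refl
  factProd*wordCount (r ∷ rs) = begin
    (r ! * factProd rs) * (binWords r (vsum rs) * wordCount rs)   ≡⟨ rearrange (r !) (factProd rs) (binWords r (vsum rs)) (wordCount rs) ⟩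
    binWords r (vsum rs) * (r ! * (factProd rs * wordCount rs))   ≡⟨ cong (λ t → binWords r (vsum rs) * (r ! * t)) (factProd*wordCount rs) ⟩
    binWords r (vsum rs) * (r ! * (vsum rs) !)                     ≡⟨ binWords-factorial r (vsum rs) ⟩
    (r + vsum rs) !                                                ∎
    where
    open ≡-Reasoning
    rearrange : ∀ a f b w → (a * f) * (b * w) ≡ b * (a * (f * w))
    rearrange = solve-∀

  multinomial≡wordCount : {m : ℕ} (rs : Vec ℕ m) → multinomial (vsum rs) rs ≡ wordCount rs
  multinomial≡wordCount rs = begin
    divide ((vsum rs) !)                 ≡⟨ cong divide (factProd*wordCount rs) ⟨
    divide (factProd rs * wordCount rs)  ≡⟨ cong divide (ℕP.*-comm (factProd rs) (wordCount rs)) ⟩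
    divide (wordCount rs * factProd rs)  ≡⟨ m*n/n≡m (wordCount rs) (factProd rs) {{factProd≢0 rs}} ⟩
    wordCount rs                         ∎
    where
    open ≡-Reasoning
    divide : ℕ → ℕ
    divide x = (x / factProd rs) {{factProd≢0 rs}}


module PowerSeries where

  open import Data.Nat as ℕ using (ℕ; zero; suc; _∸_; _≤_; _<_; z≤n; s≤s)
  import Data.Nat.Properties as ℕP
  open import Data.Integer using (ℤ; +_; _+_; _*_; _-_; -_)
  import Data.Integer.Properties as ℤP
  open import Data.Integer.Tactic.RingSolver using (solve-∀)
  open import Data.Fin using (Fin; zero; suc; toℕ)
  open import Relation.Binary.PropositionalEquality
  open import Relation.Nullary using (yes; no)

  Series : Set
  Series = ℕ → ℤ

  -- Multiplication by x^k.
  shift : ℕ → Series → Series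
  shift zero    a r       = a r
  shift (suc k) a zero    = + 0
  shift (suc k) a (suc r) = shift k a r

  -- Multiplication by 1/(1 - x): the sequence of partial sums.
  partialSums : Series → Series
  partialSums a zero    = a zero
  partialSums a (suc r) = partialSums a r + a (suc r)

  sumTo : ℕ → (ℕ → ℤ) → ℤ
  sumTo zero    f = + 0
  sumTo (suc n) f = f 0 + sumTo n (λ i → f (suc i))

  sumFinℤ : (n : ℕ) → (Fin n → ℤ) → ℤ
  sumFinℤ zero    f = + 0
  sumFinℤ (suc n) f = f zero + sumFinℤ n (λ k → f (suc k))

  shift-≥ : ∀ (a : Series) k r → k ≤ r → shift k a r ≡ a (r ∸ k)
  shift-≥ a zero    r       _       = refl
  shift-≥ a (suc k) (suc r) (s≤s h) = shift-≥ a k r h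

  shift-< : ∀ (a : Series) k r → r < k → shift k a r ≡ + 0
  shift-< a (suc k) zero    _       = refl
  shift-< a (suc k) (suc r) (s≤s h) = shift-< a k r h

  shift-cong : ∀ {a b : Series} → (∀ r → a r ≡ b r) → ∀ k r → shift k a r ≡ shift k b r
  shift-cong h zero    r       = h r
  shift-cong h (suc k) zero    = refl
  shift-cong h (suc k) (suc r) = shift-cong h k r

  partialSums-cong : ∀ {a b : Series} → (∀ r → a r ≡ b r) → ∀ r → partialSums a r ≡ partialSums b r
  partialSums-cong h zero    = h zero
  partialSums-cong h (suc r) = cong₂ _+_ (partialSums-cong h r) (h (suc r))

  sumTo-cong : ∀ n {f g : ℕ → ℤ} → (∀ i → i < n → f i ≡ g i) → sumTo n f ≡ sumTo n g
  sumTo-cong zero    h = refl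
  sumTo-cong (suc n) h = cong₂ _+_ (h 0 (s≤s z≤n)) (sumTo-cong n (λ i i<n → h (suc i) (s≤s i<n)))

  sumFinℤ-cong : ∀ n {f g : Fin n → ℤ} → (∀ k → f k ≡ g k) → sumFinℤ n f ≡ sumFinℤ n g
  sumFinℤ-cong zero    h = refl
  sumFinℤ-cong (suc n) h = cong₂ _+_ (h zero) (sumFinℤ-cong n (λ k → h (suc k)))

  sumTo-+ : ∀ n (f g : ℕ → ℤ) → sumTo n (λ i → f i + g i) ≡ sumTo n f + sumTo n g
  sumTo-+ zero    f g = refl
  sumTo-+ (suc n) f g = trans (cong (λ t → (f 0 + g 0) + t) (sumTo-+ n (λ i → f (suc i)) (λ i → g (suc i))))
    (interchange (f 0) (g 0) (sumTo n (λ i → f (suc i))) (sumTo n (λ i → g (suc i))))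
    where
    interchange : ∀ a b c d → a + b + (c + d) ≡ a + c + (b + d)
    interchange = solve-∀

  sumTo-neg : ∀ n (f : ℕ → ℤ) → sumTo n (λ i → - f i) ≡ - sumTo n f
  sumTo-neg zero    f = refl
  sumTo-neg (suc n) f = trans (cong (λ t → - f 0 + t) (sumTo-neg n (λ i → f (suc i)))) (sym (ℤP.neg-distrib-+ (f 0) _))

  sumTo-zero : ∀ n (f : ℕ → ℤ) → (∀ i → f i ≡ + 0) → sumTo n f ≡ + 0
  sumTo-zero zero    f h = refl
  sumTo-zero (suc n) f h = cong₂ _+_ (h 0) (sumTo-zero n (λ i → f (suc i)) (λ i → h (suc i)))

  sumTo-last : ∀ n (f : ℕ → ℤ) → sumTo (suc n) f ≡ sumTo n f + f n
  sumTo-last zero    f = trans (ℤP.+-identityʳ (f 0)) (sym (ℤP.+-identityˡ (f 0)))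
  sumTo-last (suc n) f = trans (cong (λ t → f 0 + t) (sumTo-last n (λ i → f (suc i)))) (sym (ℤP.+-assoc (f 0) _ _))

  sumTo-vanishing : ∀ M N (f : ℕ → ℤ) → M ≤ N → (∀ i → M ≤ i → f i ≡ + 0) → sumTo N f ≡ sumTo M f
  sumTo-vanishing M zero    f z≤n  h = refl
  sumTo-vanishing M (suc N) f M≤1+N h with M ℕ.≟ suc N
  ... | yes refl = refl
  ... | no  M≢1+N = begin
    sumTo (suc N) f   ≡⟨ sumTo-last N f ⟩
    sumTo N f + f N   ≡⟨ cong (λ t → sumTo N f + t) (h N M≤N) ⟩
    sumTo N f + + 0   ≡⟨ ℤP.+-identityʳ _ ⟩
    sumTo N f         ≡⟨ sumTo-vanishing M N f M≤N h ⟩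
    sumTo M f         ∎
    where
    open ≡-Reasoning
    M≤N : M ≤ N
    M≤N = ℕP.≤-pred (ℕP.≤∧≢⇒< M≤1+N M≢1+N)

  partialSums-linear : ∀ n (α : ℕ → ℤ) (F : ℕ → Series) r →
    partialSums (λ r → sumTo n (λ i → α i * F i r)) r ≡ sumTo n (λ i → α i * partialSums (F i) r)
  partialSums-linear n α F zero    = refl
  partialSums-linear n α F (suc r) = begin
    partialSums (λ r → sumTo n (λ i → α i * F i r)) r + sumTo n (λ i → α i * F i (suc r))
      ≡⟨ cong (_+ sumTo n (λ i → α i * F i (suc r))) (partialSums-linear n α F r) ⟩
    sumTo n (λ i → α i * partialSums (F i) r) + sumTo n (λ i → α i * F i (suc r))
      ≡⟨ sumTo-+ n (λ i → α i * partialSums (F i) r) (λ i → α i * F i (suc r)) ⟨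
    sumTo n (λ i → α i * partialSums (F i) r + α i * F i (suc r))
      ≡⟨ sumTo-cong n (λ i _ → ℤP.*-distribˡ-+ (α i) (partialSums (F i) r) (F i (suc r))) ⟨
    sumTo n (λ i → α i * partialSums (F i) (suc r)) ∎
    where open ≡-Reasoning

  shift-linear : ∀ n (α : ℕ → ℤ) (F : ℕ → Series) k r →
    shift k (λ r → sumTo n (λ i → α i * F i r)) r ≡ sumTo n (λ i → α i * shift k (F i) r)
  shift-linear n α F zero    r       = refl
  shift-linear n α F (suc k) zero    = sym (sumTo-zero n _ (λ i → ℤP.*-zeroʳ (α i)))
  shift-linear n α F (suc k) (suc r) = shift-linear n α F k r

  shift-shift : ∀ (a : Series) k l r → shift k (shift l a) r ≡ shift (k ℕ.+ l) a r
  shift-shift a zero    l r       = refl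
  shift-shift a (suc k) l zero    = refl
  shift-shift a (suc k) l (suc r) = shift-shift a k l r

  shift-suc : ∀ (a : Series) k r → shift (suc k) a r ≡ shift k (shift 1 a) r
  shift-suc a k r = trans (cong (λ n → shift n a r) (ℕP.+-comm 1 k)) (sym (shift-shift a k 1 r))

  shift-partialSums-step : ∀ (a : Series) k r → shift k (partialSums a) r ≡ shift (suc k) (partialSums a) r + shift k a r
  shift-partialSums-step a zero    zero    = sym (ℤP.+-identityˡ (a 0))
  shift-partialSums-step a zero    (suc r) = refl
  shift-partialSums-step a (suc k) zero    = refl
  shift-partialSums-step a (suc k) (suc r) = shift-partialSums-step a k r

  partialSums-shift : ∀ (a : Series) k r → partialSums (shift k a) r ≡ shift k (partialSums a) r
  partialSums-shift a zero    r       = refl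
  partialSums-shift a (suc k) zero    = refl
  partialSums-shift a (suc k) (suc r) =
    trans (cong (_+ shift k a r) (partialSums-shift a (suc k) r)) (sym (shift-partialSums-step a k r))

  partialSums-unfold : ∀ (a : Series) r → a r + shift 1 (partialSums a) r ≡ partialSums a r
  partialSums-unfold a zero    = ℤP.+-identityʳ (a 0)
  partialSums-unfold a (suc r) = ℤP.+-comm (a (suc r)) (partialSums a r)

  -- Multiplication by 1 + x + ⋯ + x^J is multiplication by (1 - x^{J+1})/(1 - x).
  window : ∀ J (a : Series) r →
    sumFinℤ (suc J) (λ k → shift (toℕ k) a r) ≡ partialSums a r - shift (suc J) (partialSums a) r
  window zero a r = begin
    a r + + 0                                               ≡⟨ ℤP.+-identityʳ (a r) ⟩
    a r                                                     ≡⟨ cancel (a r) (shift 1 (partialSums a) r) ⟨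
    (a r + shift 1 (partialSums a) r) - shift 1 (partialSums a) r ≡⟨ cong (_- shift 1 (partialSums a) r) (partialSums-unfold a r) ⟩
    partialSums a r - shift 1 (partialSums a) r            ∎
    where
    open ≡-Reasoning
    cancel : ∀ x y → (x + y) - y ≡ x
    cancel = solve-∀
  window (suc J) a r = begin
    a r + sumFinℤ (suc J) (λ k → shift (suc (toℕ k)) a r)
      ≡⟨ cong (λ t → a r + t) (sumFinℤ-cong (suc J) (λ k → shift-suc a (toℕ k) r)) ⟩
    a r + sumFinℤ (suc J) (λ k → shift (toℕ k) (shift 1 a) r)
      ≡⟨ cong (λ t → a r + t) (window J (shift 1 a) r) ⟩
    a r + (partialSums (shift 1 a) r - shift (suc J) (partialSums (shift 1 a)) r)
      ≡⟨ cong₂ (λ x y → a r + (x - y)) (partialSums-shift a 1 r)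
           (trans (shift-cong (partialSums-shift a 1) (suc J) r) (sym (shift-suc (partialSums a) (suc J) r))) ⟩
    a r + (shift 1 (partialSums a) r - shift (suc (suc J)) (partialSums a) r)
      ≡⟨ ℤP.+-assoc (a r) _ _ ⟨
    a r + shift 1 (partialSums a) r - shift (suc (suc J)) (partialSums a) r
      ≡⟨ cong (_- shift (suc (suc J)) (partialSums a) r) (partialSums-unfold a r) ⟩
    partialSums a r - shift (suc (suc J)) (partialSums a) r ∎
    where open ≡-Reasoning


module BoundedCompositions (j : ℕ) where

  open Bijections
  open PowerSeries
  open import Data.Nat as ℕ using (zero; suc; _∸_; _≤_; _<_; _/_)
  import Data.Nat.Properties as ℕP
  open import Data.Nat.DivMod using (m/n*n≤m; /-monoˡ-≤; m*n/n≡m)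
  open import Data.Nat.Combinatorics using (_C_; k>n⇒nCk≡0; nCn≡1; nCk+nC[k+1]≡[n+1]C[k+1])
  open import Data.Integer using (ℤ; +_; -[1+_]; _+_; _*_; _-_; -_; _^_)
  import Data.Integer.Properties as ℤP
  open import Data.Integer.Tactic.RingSolver using (solve-∀)
  open import Data.Fin using (Fin; zero; suc; toℕ)
  open import Data.Vec using (Vec; []; _∷_)
  open import Data.Product using (Σ; _,_)
  import Data.List as List
  open import Function.Bundles using (_↔_)
  open import Relation.Binary.PropositionalEquality
  open import Relation.Nullary using (yes; no; contradiction)

  -- Parts are bounded by j; c = j + 1 is the number of possible part sizes.
  c : ℕ
  c = suc j

  partSum : {p : ℕ} → Vec (Fin c) p → ℕ
  partSum []       = 0
  partSum (k ∷ ks) = toℕ k ℕ.+ partSum ks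

  Composition : ℕ → ℕ → Set
  Composition p r = Σ (Vec (Fin c) p) (λ ks → partSum ks ≡ r)

  shiftℕ : ℕ → (ℕ → ℕ) → ℕ → ℕ
  shiftℕ zero    a r       = a r
  shiftℕ (suc k) a zero    = 0
  shiftℕ (suc k) a (suc r) = shiftℕ k a r

  compositions : ℕ → ℕ → ℕ
  compositions zero    zero    = 1
  compositions zero    (suc r) = 0
  compositions (suc p) r       = sumFin c (λ k → shiftℕ (toℕ k) (compositions p) r)

  mutual
    Composition↔Fin : ∀ p r → Composition p r ↔ Fin (compositions p r)
    Composition↔Fin zero    zero    = singleton↔Fin1 ([] , refl) (λ { ([] , refl) → refl })
    Composition↔Fin zero    (suc r) = empty↔Fin0 (λ { ([] , ()) })
    Composition↔Fin (suc p) r       =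
      Σ-Vec-suc ⟫ Σ-↔-fibres (λ k → rest↔Fin p (toℕ k) r) ⟫ ΣFin↔Fin-sum c (λ k → shiftℕ (toℕ k) (compositions p) r)

    rest↔Fin : ∀ p k r → Σ (Vec (Fin c) p) (λ ks → k ℕ.+ partSum ks ≡ r) ↔ Fin (shiftℕ k (compositions p) r)
    rest↔Fin p zero    r       = Composition↔Fin p r
    rest↔Fin p (suc k) zero    = empty↔Fin0 (λ { (_ , ()) })
    rest↔Fin p (suc k) (suc r) = Σ-↔-pred ℕP.suc-injective (cong suc) ℕP.≡-irrelevant ℕP.≡-irrelevant ⟫ rest↔Fin p k r

  -- Generating functions: Σ_r compositions p r x^r = ((1 - x^c)/(1 - x))^p.

  compositionSeries : ℕ → Series
  compositionSeries p r = + compositions p r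

  -- Coefficients of (1 - x)^{-p}.
  inversePower : ℕ → Series
  inversePower zero    zero    = + 1
  inversePower zero    (suc r) = + 0
  inversePower (suc p) = partialSums (inversePower p)

  sign : ℕ → ℤ
  sign i = -[1+ 0 ] ^ i

  signedBinomial : ℕ → ℕ → ℤ
  signedBinomial p i = sign i * + (p C i)

  +sumFin : ∀ n (h : Fin n → ℕ) → + sumFin n h ≡ sumFinℤ n (λ k → + h k)
  +sumFin zero    h = refl
  +sumFin (suc n) h = trans (ℤP.pos-+ (h zero) _) (cong (λ t → + h zero + t) (+sumFin n (λ k → h (suc k))))

  +shiftℕ : ∀ k (a : ℕ → ℕ) r → + shiftℕ k a r ≡ shift k (λ r → + a r) r
  +shiftℕ zero    a r       = refl
  +shiftℕ (suc k) a zero    = refl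
  +shiftℕ (suc k) a (suc r) = +shiftℕ k a r

  -- One more part multiplies the generating function by (1 - x^c)/(1 - x).
  compositionSeries-suc : ∀ p r →
    compositionSeries (suc p) r ≡ partialSums (compositionSeries p) r - shift c (partialSums (compositionSeries p)) r
  compositionSeries-suc p r = begin
    + sumFin c (λ k → shiftℕ (toℕ k) (compositions p) r)        ≡⟨ +sumFin c (λ k → shiftℕ (toℕ k) (compositions p) r) ⟩
    sumFinℤ c (λ k → + shiftℕ (toℕ k) (compositions p) r)       ≡⟨ sumFinℤ-cong c (λ k → +shiftℕ (toℕ k) (compositions p) r) ⟩
    sumFinℤ c (λ k → shift (toℕ k) (compositionSeries p) r)     ≡⟨ window j (compositionSeries p) r ⟩
    partialSums (compositionSeries p) r - shift c (partialSums (compositionSeries p)) r ∎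
    where open ≡-Reasoning

  signedBinomial-suc : ∀ p i → signedBinomial (suc p) (suc i) ≡ signedBinomial p (suc i) - signedBinomial p i
  signedBinomial-suc p i = begin
    sign (suc i) * + (suc p C suc i)                  ≡⟨ cong (λ t → sign (suc i) * + t) (nCk+nC[k+1]≡[n+1]C[k+1] p i) ⟨
    sign (suc i) * + (p C i ℕ.+ p C suc i)            ≡⟨ cong (sign (suc i) *_) (ℤP.pos-+ (p C i) (p C suc i)) ⟩
    sign (suc i) * (+ (p C i) + + (p C suc i))        ≡⟨ cong (λ t → t * (+ (p C i) + + (p C suc i))) (ℤP.-1*i≡-i (sign i)) ⟩
    (- sign i) * (+ (p C i) + + (p C suc i))          ≡⟨ distribute (sign i) (+ (p C i)) (+ (p C suc i)) ⟩
    (- sign i) * + (p C suc i) - sign i * + (p C i)   ≡⟨ cong (λ t → t * + (p C suc i) - sign i * + (p C i)) (ℤP.-1*i≡-i (sign i)) ⟨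
    signedBinomial p (suc i) - signedBinomial p i     ∎
    where
    open ≡-Reasoning
    distribute : ∀ e a b → (- e) * (a + b) ≡ (- e) * b - e * a
    distribute = solve-∀

  signedBinomial-> : ∀ p i → p < i → signedBinomial p i ≡ + 0
  signedBinomial-> p i p<i = trans (cong (λ t → sign i * + t) (k>n⇒nCk≡0 p<i)) (ℤP.*-zeroʳ (sign i))

  -- (1 - y) Σ_i (-1)^i C(p,i) y^i = Σ_i (-1)^i C(p+1,i) y^i, for y^i ↦ X i.
  binomial-times-1-y : ∀ p (X : ℕ → ℤ) →
    sumTo (suc p) (λ i → signedBinomial p i * X i) - sumTo (suc p) (λ i → signedBinomial p i * X (suc i))
      ≡ sumTo (suc (suc p)) (λ i → signedBinomial (suc p) i * X i)
  binomial-times-1-y p X = sym (begin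
    + 1 * X 0 + sumTo (suc p) (λ i → signedBinomial (suc p) (suc i) * X (suc i))
      ≡⟨ cong (λ t → + 1 * X 0 + t) (trans (sumTo-cong (suc p) (λ i _ → trans (cong (_* X (suc i)) (signedBinomial-suc p i))
           (ℤP.*-distribʳ-+ (X (suc i)) (signedBinomial p (suc i)) (- signedBinomial p i))))
           (sumTo-+ (suc p) (λ i → signedBinomial p (suc i) * X (suc i)) (λ i → (- signedBinomial p i) * X (suc i)))) ⟩
    + 1 * X 0 + (sumTo (suc p) (λ i → signedBinomial p (suc i) * X (suc i)) + sumTo (suc p) (λ i → (- signedBinomial p i) * X (suc i)))
      ≡⟨ cong₂ (λ s t → + 1 * X 0 + (s + t)) top-term-vanishes negated ⟩
    + 1 * X 0 + ((A + + 0) + - B)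
      ≡⟨ regroup (X 0) A B ⟩
    + 1 * X 0 + A - B ∎)
    where
    open ≡-Reasoning
    A = sumTo p (λ i → signedBinomial p (suc i) * X (suc i))
    B = sumTo (suc p) (λ i → signedBinomial p i * X (suc i))
    top-term-vanishes : sumTo (suc p) (λ i → signedBinomial p (suc i) * X (suc i)) ≡ A + + 0
    top-term-vanishes = trans (sumTo-last p _)
      (cong (λ t → A + t) (trans (cong (_* X (suc p)) (signedBinomial-> p (suc p) (ℕP.n<1+n p))) (ℤP.*-zeroˡ (X (suc p)))))
    negated : sumTo (suc p) (λ i → (- signedBinomial p i) * X (suc i)) ≡ - B
    negated = trans (sumTo-cong (suc p) (λ i _ → sym (ℤP.neg-distribˡ-* (signedBinomial p i) (X (suc i)))))
      (sumTo-neg (suc p) (λ i → signedBinomial p i * X (suc i)))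
    regroup : ∀ x a b → + 1 * x + ((a + + 0) + - b) ≡ + 1 * x + a - b
    regroup = solve-∀

  -- compositionSeries p = (1 - x^c)^p (1 - x)^{-p}, coefficientwise.
  compositionSeries-expansion : ∀ p r →
    compositionSeries p r ≡ sumTo (suc p) (λ i → signedBinomial p i * shift (i ℕ.* c) (inversePower p) r)
  compositionSeries-expansion zero    zero    = refl
  compositionSeries-expansion zero    (suc r) = refl
  compositionSeries-expansion (suc p) r       = begin
    compositionSeries (suc p) r
      ≡⟨ compositionSeries-suc p r ⟩
    partialSums (compositionSeries p) r - shift c (partialSums (compositionSeries p)) r
      ≡⟨ cong₂ _-_ (partialSums-expansion r)
           (trans (shift-cong partialSums-expansion c r)
             (trans (shift-linear (suc p) (signedBinomial p) (λ i → shift (i ℕ.* c) G) c r)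
               (sumTo-cong (suc p) (λ i _ → cong (signedBinomial p i *_) (shift-shift G c (i ℕ.* c) r))))) ⟩
    sumTo (suc p) (λ i → signedBinomial p i * X i) - sumTo (suc p) (λ i → signedBinomial p i * X (suc i))
      ≡⟨ binomial-times-1-y p X ⟩
    sumTo (suc (suc p)) (λ i → signedBinomial (suc p) i * X i) ∎
    where
    open ≡-Reasoning
    G = inversePower (suc p)
    X : ℕ → ℤ
    X i = shift (i ℕ.* c) G r
    partialSums-expansion : ∀ r → partialSums (compositionSeries p) r ≡ sumTo (suc p) (λ i → signedBinomial p i * shift (i ℕ.* c) G r)
    partialSums-expansion r =
      trans (partialSums-cong (compositionSeries-expansion p) r)
        (trans (partialSums-linear (suc p) (signedBinomial p) (λ i → shift (i ℕ.* c) (inversePower p)) r)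
          (sumTo-cong (suc p) (λ i _ → cong (signedBinomial p i *_) (partialSums-shift (inversePower p) (i ℕ.* c) r))))

  inversePower-coefficient : ∀ q r → inversePower (suc q) r ≡ + ((q ℕ.+ r) C q)
  inversePower-coefficient zero    r       = partialSums-one r
    where
    partialSums-one : ∀ r → partialSums (inversePower 0) r ≡ + 1
    partialSums-one zero    = refl
    partialSums-one (suc r) = trans (ℤP.+-identityʳ _) (partialSums-one r)
  inversePower-coefficient (suc q) zero    = begin
    inversePower (suc q) 0 ≡⟨ inversePower-coefficient q 0 ⟩
    + ((q ℕ.+ 0) C q)      ≡⟨ cong (λ n → + (n C q)) (ℕP.+-identityʳ q) ⟩
    + (q C q)              ≡⟨ cong +_ (trans (nCn≡1 q) (sym (nCn≡1 (suc q)))) ⟩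
    + (suc q C suc q)      ≡⟨ cong (λ n → + (n C suc q)) (ℕP.+-identityʳ (suc q)) ⟨
    + ((suc q ℕ.+ 0) C suc q) ∎
    where open ≡-Reasoning
  inversePower-coefficient (suc q) (suc r) = begin
    inversePower (suc (suc q)) r + inversePower (suc q) (suc r)
      ≡⟨ cong₂ _+_ (inversePower-coefficient (suc q) r) (inversePower-coefficient q (suc r)) ⟩
    + ((suc q ℕ.+ r) C suc q) + + ((q ℕ.+ suc r) C q)
      ≡⟨ ℤP.pos-+ ((suc q ℕ.+ r) C suc q) ((q ℕ.+ suc r) C q) ⟨
    + ((suc q ℕ.+ r) C suc q ℕ.+ (q ℕ.+ suc r) C q)
      ≡⟨ cong (λ n → + (n C suc q ℕ.+ (q ℕ.+ suc r) C q)) (ℕP.+-suc q r) ⟨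
    + ((q ℕ.+ suc r) C suc q ℕ.+ (q ℕ.+ suc r) C q)
      ≡⟨ cong +_ (trans (ℕP.+-comm ((q ℕ.+ suc r) C suc q) _) (nCk+nC[k+1]≡[n+1]C[k+1] (q ℕ.+ suc r) q)) ⟩
    + (suc (q ℕ.+ suc r) C suc q) ∎
    where open ≡-Reasoning

  foldr-map-applyUpTo : ∀ (g : ℕ → ℤ) (h : ℕ → ℕ) n →
    List.foldr _+_ (+ 0) (List.map g (List.applyUpTo h n)) ≡ sumTo n (λ i → g (h i))
  foldr-map-applyUpTo g h zero    = refl
  foldr-map-applyUpTo g h (suc n) = cong (λ t → g (h 0) + t) (foldr-map-applyUpTo g (λ i → h (suc i)) n)

  compositions≡altSum : ∀ q r → + compositions (suc q) r ≡ altSum (suc q) j r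
  compositions≡altSum q r = begin
    compositionSeries p r  ≡⟨ compositionSeries-expansion p r ⟩
    sumTo (suc p) term     ≡⟨ sumTo-vanishing (suc p) K term (ℕP.m≤m+n (suc p) B) (λ i → binomial-vanishes i) ⟨
    sumTo K term           ≡⟨ sumTo-vanishing B K term (ℕP.m≤n+m B (suc p)) (λ i → shift-vanishes i) ⟩
    sumTo B term           ≡⟨ sumTo-cong B summand≡term ⟨
    sumTo B summand        ≡⟨ foldr-map-applyUpTo summand (λ i → i) B ⟨
    altSum p j r           ∎
    where
    open ≡-Reasoning
    p = suc q
    B = suc (r / c)
    K = suc p ℕ.+ B
    term : ℕ → ℤ
    term i = signedBinomial p i * shift (i ℕ.* c) (inversePower p) r
    summand : ℕ → ℤ
    summand i = sign i * + ((p C i) ℕ.* ((p ℕ.+ r ∸ i ℕ.* c ∸ 1) C (p ∸ 1)))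

    binomial-vanishes : ∀ i → suc p ≤ i → term i ≡ + 0
    binomial-vanishes i p<i = trans (cong (_* shift (i ℕ.* c) (inversePower p) r) (signedBinomial-> p i p<i)) (ℤP.*-zeroˡ (shift (i ℕ.* c) (inversePower p) r))

    shift-vanishes : ∀ i → B ≤ i → term i ≡ + 0
    shift-vanishes i B≤i with i ℕ.* c ℕ.≤? r
    ... | yes ic≤r = contradiction (ℕP.≤-trans B≤i (subst (_≤ r / c) (m*n/n≡m i c) (/-monoˡ-≤ c ic≤r))) (ℕP.n≮n (r / c))
    ... | no  ic≰r = trans (cong (signedBinomial p i *_) (shift-< (inversePower p) (i ℕ.* c) r (ℕP.≰⇒> ic≰r))) (ℤP.*-zeroʳ (signedBinomial p i))

    summand≡term : ∀ i → i < B → summand i ≡ term i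
    summand≡term i i<B = begin
      sign i * + ((p C i) ℕ.* ((p ℕ.+ r ∸ i ℕ.* c ∸ 1) C q))   ≡⟨ cong (λ t → sign i * + ((p C i) ℕ.* ((t ∸ 1) C q))) (ℕP.+-∸-assoc p ic≤r) ⟩
      sign i * + ((p C i) ℕ.* ((q ℕ.+ (r ∸ i ℕ.* c)) C q))     ≡⟨ cong (sign i *_) (ℤP.pos-* (p C i) _) ⟩
      sign i * (+ (p C i) * + ((q ℕ.+ (r ∸ i ℕ.* c)) C q))     ≡⟨ ℤP.*-assoc (sign i) _ _ ⟨
      signedBinomial p i * + ((q ℕ.+ (r ∸ i ℕ.* c)) C q)       ≡⟨ cong (signedBinomial p i *_) (inversePower-coefficient q (r ∸ i ℕ.* c)) ⟨
      signedBinomial p i * inversePower p (r ∸ i ℕ.* c)        ≡⟨ cong (signedBinomial p i *_) (shift-≥ (inversePower p) (i ℕ.* c) r ic≤r) ⟨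
      term i                                                   ∎
      where
      ic≤r : i ℕ.* c ≤ r
      ic≤r = ℕP.≤-trans (ℕP.*-monoˡ-≤ c (ℕP.≤-pred i<B)) (m/n*n≤m r c)


module MatrixEncoding where

  open Bijections
  open import Data.Nat as ℕ using (ℕ; zero; suc; _+_; _∸_; _≤_; _≡ᵇ_)
  import Data.Nat.Properties as ℕP
  open import Data.Bool using (if_then_else_; T)
  open import Data.Bool.Properties using (T-∧; T-irrelevant)
  open import Data.Unit using (tt)
  open import Data.Fin using (Fin; zero; suc; toℕ)
  open import Data.List as List using (List; []; _∷_; length; take; drop; _++_)
  open import Data.Nat.ListAction using (sum)
  open import Data.Nat.ListAction.Properties using (sum-++)
  import Data.List.Properties as ListP
  open import Data.Vec using (Vec; []; _∷_; replicate; map; allFin)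
  import Data.Vec.Properties as VecP
  open import Data.Product using (Σ; _×_; _,_; proj₁; proj₂)
  open import Function.Bundles using (_↔_; Equivalence)
  open import Relation.Binary.PropositionalEquality

  listStat : (ℕ → ℕ) → List ℕ → ℕ
  listStat h w = sum (List.map h w)

  listStat-++ : ∀ h u v → listStat h (u ++ v) ≡ listStat h u + listStat h v
  listStat-++ h u v = trans (cong sum (ListP.map-++ h u v)) (sum-++ (List.map h u) _)

  take-+ : ∀ a b (w : List ℕ) → take (a + b) w ≡ take a w ++ take b (drop a w)
  take-+ zero    b w       = refl
  take-+ (suc a) b []      = sym (ListP.take-[] b)
  take-+ (suc a) b (x ∷ w) = cong (x ∷_) (take-+ a b w)

  drop-length-++ : ∀ (u v : List ℕ) → drop (length u) (u ++ v) ≡ v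
  drop-length-++ []      v = refl
  drop-length-++ (x ∷ u) v = drop-length-++ u v

  -- Rows of the form (a₁, …, aᵢ, 0, …, 0) with all aₗ ≥ 1 correspond to
  -- pairs (i, (a₁ - 1, …, aᵢ - 1)).  fillRow k w is the row whose first k
  -- entries are one more than the first k elements of w, followed by zeros.
  fillRow : {j : ℕ} → Fin (suc j) → List ℕ → Vec ℕ j
  fillRow {j}     zero    w       = replicate j 0
  fillRow {suc j} (suc k) []      = replicate (suc j) 0
  fillRow {suc j} (suc k) (x ∷ w) = suc x ∷ fillRow k w

  readRow : {j : ℕ} → Vec ℕ j → Fin (suc j) × List ℕ
  readRow []           = zero , []
  readRow (zero ∷ xs)  = zero , []
  readRow (suc x ∷ xs) = suc (proj₁ (readRow xs)) , x ∷ proj₂ (readRow xs)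

  rowStat : {j : ℕ} → (ℕ → ℕ) → Vec ℕ j → ℕ
  rowStat h []           = 0
  rowStat h (zero ∷ xs)  = rowStat h xs
  rowStat h (suc x ∷ xs) = h x + rowStat h xs

  allZero-replicate : ∀ n → T (allZero (replicate n 0))
  allZero-replicate zero    = tt
  allZero-replicate (suc n) = allZero-replicate n

  allZero⇒replicate : ∀ {n} (xs : Vec ℕ n) → T (allZero xs) → replicate n 0 ≡ xs
  allZero⇒replicate []          _ = refl
  allZero⇒replicate (zero ∷ xs) z = cong (0 ∷_) (allZero⇒replicate xs z)

  rowStat-replicate : ∀ h n → rowStat h (replicate n 0) ≡ 0
  rowStat-replicate h zero    = refl
  rowStat-replicate h (suc n) = rowStat-replicate h n

  fillRow-rowForm : {j : ℕ} (k : Fin (suc j)) (w : List ℕ) → T (rowForm (fillRow k w))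
  fillRow-rowForm {zero}  zero    w       = tt
  fillRow-rowForm {suc j} zero    w       = allZero-replicate j
  fillRow-rowForm {suc j} (suc k) []      = allZero-replicate j
  fillRow-rowForm {suc j} (suc k) (x ∷ w) = fillRow-rowForm k w

  length-readRow : {j : ℕ} (row : Vec ℕ j) → length (proj₂ (readRow row)) ≡ toℕ (proj₁ (readRow row))
  length-readRow []           = refl
  length-readRow (zero ∷ xs)  = refl
  length-readRow (suc x ∷ xs) = cong suc (length-readRow xs)

  fillRow-readRow : {j : ℕ} (row : Vec ℕ j) → T (rowForm row) → ∀ rest →
    fillRow (proj₁ (readRow row)) (proj₂ (readRow row) ++ rest) ≡ row
  fillRow-readRow []           _ rest = refl
  fillRow-readRow (zero ∷ xs)  z rest = cong (0 ∷_) (allZero⇒replicate xs z)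
  fillRow-readRow (suc x ∷ xs) f rest = cong (suc x ∷_) (fillRow-readRow xs f rest)

  readRow-fillRow : {j : ℕ} (k : Fin (suc j)) (w : List ℕ) → toℕ k ≤ length w → readRow (fillRow k w) ≡ (k , take (toℕ k) w)
  readRow-fillRow {zero}  zero    w       _          = refl
  readRow-fillRow {suc j} zero    w       _          = refl
  readRow-fillRow {suc j} (suc k) (x ∷ w) (ℕ.s≤s k≤) = cong (λ (k′ , u) → suc k′ , x ∷ u) (readRow-fillRow k w k≤)

  rowStat-fillRow : {j : ℕ} → ∀ h (k : Fin (suc j)) w → rowStat h (fillRow k w) ≡ listStat h (take (toℕ k) w)
  rowStat-fillRow {j}     h zero    w       = rowStat-replicate h j
  rowStat-fillRow {suc j} h (suc k) []      = rowStat-replicate h (suc j)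
  rowStat-fillRow {suc j} h (suc k) (x ∷ w) = cong (h x +_) (rowStat-fillRow h k w)

  fillMatrix : {j p : ℕ} → Vec (Fin (suc j)) p → List ℕ → Matrix p j
  fillMatrix []       w = []
  fillMatrix (k ∷ ks) w = fillRow k w ∷ fillMatrix ks (drop (toℕ k) w)

  readMatrix : {j p : ℕ} → Matrix p j → Vec (Fin (suc j)) p × List ℕ
  readMatrix []          = [] , []
  readMatrix (row ∷ rows) =
    proj₁ (readRow row) ∷ proj₁ (readMatrix rows) , proj₂ (readRow row) ++ proj₂ (readMatrix rows)

  module _ {j : ℕ} where
    open BoundedCompositions j using (partSum)

    partSum-readMatrix : ∀ {p} (B : Matrix p j) → partSum (proj₁ (readMatrix B)) ≡ length (proj₂ (readMatrix B))
    partSum-readMatrix []          = refl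
    partSum-readMatrix (row ∷ rows) =
      trans (cong₂ _+_ (sym (length-readRow row)) (partSum-readMatrix rows)) (sym (ListP.length-++ (proj₂ (readRow row))))

    fillMatrix-readMatrix : ∀ {p} (B : Matrix p j) → T (allRowsForm B) → fillMatrix (proj₁ (readMatrix B)) (proj₂ (readMatrix B)) ≡ B
    fillMatrix-readMatrix []           _ = refl
    fillMatrix-readMatrix (row ∷ rows) f =
      cong₂ _∷_ (fillRow-readRow row (proj₁ f′) _) (trans (cong (fillMatrix _) rest) (fillMatrix-readMatrix rows (proj₂ f′)))
      where
      f′ = Equivalence.to T-∧ f
      u = proj₂ (readRow row)
      rest : drop (toℕ (proj₁ (readRow row))) (u ++ proj₂ (readMatrix rows)) ≡ proj₂ (readMatrix rows)
      rest = trans (cong (λ n → drop n (u ++ _)) (sym (length-readRow row))) (drop-length-++ u _)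

    readMatrix-fillMatrix : ∀ {p} (ks : Vec (Fin (suc j)) p) w → partSum ks ≡ length w → readMatrix (fillMatrix ks w) ≡ (ks , w)
    readMatrix-fillMatrix []       []      _ = refl
    readMatrix-fillMatrix (k ∷ ks) w       e = begin
      readMatrix (fillMatrix (k ∷ ks) w)
        ≡⟨ cong₂ (λ a b → proj₁ a ∷ proj₁ b , proj₂ a ++ proj₂ b) (readRow-fillRow k w k≤) (readMatrix-fillMatrix ks (drop (toℕ k) w) e′) ⟩
      (k ∷ ks , take (toℕ k) w ++ drop (toℕ k) w)
        ≡⟨ cong (k ∷ ks ,_) (ListP.take++drop≡id (toℕ k) w) ⟩
      (k ∷ ks , w) ∎
      where
      open ≡-Reasoning
      k≤ : toℕ k ≤ length w
      k≤ = subst (toℕ k ≤_) e (ℕP.m≤m+n (toℕ k) (partSum ks))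
      e′ : partSum ks ≡ length (drop (toℕ k) w)
      e′ = sym (trans (ListP.length-drop (toℕ k) w) (trans (cong (_∸ toℕ k) (sym e)) (ℕP.m+n∸m≡n (toℕ k) (partSum ks))))

    fillMatrix-allRowsForm : ∀ {p} (ks : Vec (Fin (suc j)) p) w → T (allRowsForm (fillMatrix ks w))
    fillMatrix-allRowsForm []       w = tt
    fillMatrix-allRowsForm (k ∷ ks) w = Equivalence.from T-∧ (fillRow-rowForm k w , fillMatrix-allRowsForm ks (drop (toℕ k) w))

    rowStats-fillMatrix : ∀ {p} h (ks : Vec (Fin (suc j)) p) w → partSum ks ≡ length w → vsum (map (rowStat h) (fillMatrix ks w)) ≡ listStat h w
    rowStats-fillMatrix h ks w e = trans (rowStats-take h ks w) (cong (listStat h) (trans (cong (λ n → take n w) e) (ListP.take-all (length w) w ℕP.≤-refl)))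
      where
      rowStats-take : ∀ {p} h (ks : Vec (Fin (suc j)) p) w → vsum (map (rowStat h) (fillMatrix ks w)) ≡ listStat h (take (partSum ks) w)
      rowStats-take h []       w = refl
      rowStats-take h (k ∷ ks) w = begin
        rowStat h (fillRow k w) + vsum (map (rowStat h) (fillMatrix ks (drop (toℕ k) w)))
          ≡⟨ cong₂ _+_ (rowStat-fillRow h k w) (rowStats-take h ks (drop (toℕ k) w)) ⟩
        listStat h (take (toℕ k) w) + listStat h (take (partSum ks) (drop (toℕ k) w))
          ≡⟨ listStat-++ h (take (toℕ k) w) _ ⟨
        listStat h (take (toℕ k) w ++ take (partSum ks) (drop (toℕ k) w))
          ≡⟨ cong (listStat h) (take-+ (toℕ k) (partSum ks) w) ⟨
        listStat h (take (partSum (k ∷ ks)) w) ∎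
        where open ≡-Reasoning

  indicator : ℕ → ℕ → ℕ
  indicator a x = if x ≡ᵇ a then 1 else 0

  -- Entry k of multiplicities m w counts the occurrences of k in w (which
  -- encode entries equal to k + 1).
  multiplicities : (m : ℕ) → List ℕ → Vec ℕ m
  multiplicities m w = map (λ k → listStat (indicator (toℕ k)) w) (allFin m)

  vsum≡rowStat : ∀ {j} (row : Vec ℕ j) → vsum row ≡ rowStat suc row
  vsum≡rowStat []           = refl
  vsum≡rowStat (zero ∷ xs)  = vsum≡rowStat xs
  vsum≡rowStat (suc x ∷ xs) = cong (suc x +_) (vsum≡rowStat xs)

  countNonzero≡rowStat : ∀ {j} (row : Vec ℕ j) → countRow isNonzero row ≡ rowStat (λ _ → 1) row
  countNonzero≡rowStat []           = refl
  countNonzero≡rowStat (zero ∷ xs)  = countNonzero≡rowStat xs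
  countNonzero≡rowStat (suc x ∷ xs) = cong suc (countNonzero≡rowStat xs)

  countEq≡rowStat : ∀ {j} a (row : Vec ℕ j) → countRow (λ x → x ≡ᵇ suc a) row ≡ rowStat (indicator a) row
  countEq≡rowStat a []           = refl
  countEq≡rowStat a (zero ∷ xs)  = countEq≡rowStat a xs
  countEq≡rowStat a (suc x ∷ xs) = cong (indicator a x +_) (countEq≡rowStat a xs)

  listStat-const1 : ∀ w → listStat (λ _ → 1) w ≡ length w
  listStat-const1 []      = refl
  listStat-const1 (x ∷ w) = cong suc (listStat-const1 w)

  module _ {j p : ℕ} (ks : Vec (Fin (suc j)) p) (w : List ℕ) (e : BoundedCompositions.partSum j ks ≡ length w) where
    private
      viaRowStat : ∀ {φ} h → (∀ row → φ row ≡ rowStat h row) → vsum (map φ (fillMatrix ks w)) ≡ listStat h w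
      viaRowStat h φ≡ = trans (cong vsum (VecP.map-cong φ≡ (fillMatrix ks w))) (rowStats-fillMatrix h ks w e)

    entrySum-fillMatrix : entrySum (fillMatrix ks w) ≡ listStat suc w
    entrySum-fillMatrix = viaRowStat suc vsum≡rowStat

    nonzeroCount-fillMatrix : nonzeroCount (fillMatrix ks w) ≡ length w
    nonzeroCount-fillMatrix = trans (viaRowStat (λ _ → 1) countNonzero≡rowStat) (listStat-const1 w)

    entryTypes-fillMatrix : ∀ m → entryTypes m (fillMatrix ks w) ≡ multiplicities m w
    entryTypes-fillMatrix m = VecP.map-cong (λ k → viaRowStat (indicator (toℕ k)) (countEq≡rowStat (toℕ k))) (allFin m)

  Counted : {p j : ℕ} (m r : ℕ) → Vec ℕ m → Matrix p j → Set
  Counted m r rs B = T (isBMC m B) × nonzeroCount B ≡ r × entryTypes m B ≡ rs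

  Encoded : {p j : ℕ} (m r : ℕ) → Vec ℕ m → Vec (Fin (suc j)) p × List ℕ → Set
  Encoded {j = j} m r rs (ks , w) = BoundedCompositions.partSum j ks ≡ length w × listStat suc w ≡ m × length w ≡ r × multiplicities m w ≡ rs

  module _ {p j m r : ℕ} {rs : Vec ℕ m} where
    private
      C : Matrix p j → Set
      C = Counted m r rs
      E : Vec (Fin (suc j)) p × List ℕ → Set
      E = Encoded m r rs
    open BoundedCompositions j using (partSum)

    Counted-fillMatrix : ∀ ks w → E (ks , w) → C (fillMatrix ks w)
    Counted-fillMatrix ks w (e , sum≡m , len≡r , mult≡rs) =
      Equivalence.from T-∧ (fillMatrix-allRowsForm ks w , ℕP.≡⇒≡ᵇ _ _ (trans (entrySum-fillMatrix ks w e) sum≡m)) ,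
      trans (nonzeroCount-fillMatrix ks w e) len≡r ,
      trans (entryTypes-fillMatrix ks w e m) mult≡rs

    Encoded-fillMatrix : ∀ ks w → partSum ks ≡ length w → C (fillMatrix ks w) → E (ks , w)
    Encoded-fillMatrix ks w e (isBMC , nz≡r , types≡rs) =
      e ,
      trans (sym (entrySum-fillMatrix ks w e)) (ℕP.≡ᵇ⇒≡ _ _ (proj₂ (Equivalence.to T-∧ isBMC))) ,
      trans (sym (nonzeroCount-fillMatrix ks w e)) nz≡r ,
      trans (sym (entryTypes-fillMatrix ks w e m)) types≡rs

    wellFormed : ∀ B → C B → T (allRowsForm B)
    wellFormed B (isBMC , _) = proj₁ (Equivalence.to T-∧ isBMC)

    Encoded-readMatrix : ∀ B → C B → E (readMatrix B)
    Encoded-readMatrix B c = Encoded-fillMatrix ks w (partSum-readMatrix B) (subst C (sym (fillMatrix-readMatrix B (wellFormed B c))) c)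
      where
      ks = proj₁ (readMatrix B)
      w = proj₂ (readMatrix B)

    Counted↔Encoded : Σ (Matrix p j) C ↔ Σ (Vec (Fin (suc j)) p × List ℕ) E
    Counted↔Encoded = Σ-↔-restrict (λ B _ → readMatrix B) (λ (ks , w) → fillMatrix ks w)
      Encoded-readMatrix (λ (ks , w) → Counted-fillMatrix ks w)
      (λ B c → fillMatrix-readMatrix B (wellFormed B c))
      (λ (ks , w) (e , _) → readMatrix-fillMatrix ks w e)
      (×-irrelevant T-irrelevant (×-irrelevant ℕP.≡-irrelevant ≡Vec-irrelevant))
      (×-irrelevant ℕP.≡-irrelevant (×-irrelevant ℕP.≡-irrelevant (×-irrelevant ℕP.≡-irrelevant ≡Vec-irrelevant)))


module LetterEncoding where

  open Bijections
  open WordCounting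
  open MatrixEncoding
  open import Data.Nat using (ℕ; zero; suc; _+_; _*_; _≤_)
  import Data.Nat.Properties as ℕP
  open import Data.Nat.Tactic.RingSolver using (solve-∀)
  open import Data.Fin using (Fin; zero; suc; toℕ; fromℕ<)
  import Data.Fin.Properties as FinP
  open import Data.List as List using (List; []; _∷_; length)
  import Data.List.Properties as ListP
  open import Data.Vec using (Vec; []; _∷_; map; allFin; lookup)
  import Data.Vec.Properties as VecP
  open import Data.Product using (Σ; _×_; _,_; proj₁; proj₂)
  open import Function.Bundles using (_↔_)
  open import Relation.Binary.PropositionalEquality

  weight : {m : ℕ} → Vec ℕ m → ℕ
  weight {m} rs = vsum (map (λ k → suc (toℕ k) * lookup rs k) (allFin m))

  map-allFin-suc : {A : Set} {m : ℕ} (f : Fin (suc m) → A) → map f (allFin (suc m)) ≡ f zero ∷ map (λ k → f (suc k)) (allFin m)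
  map-allFin-suc f = cong (f zero ∷_) (trans (sym (VecP.tabulate-∘ f suc)) (VecP.tabulate-allFin (λ k → f (suc k))))

  vsum-map-+ : {m n : ℕ} (f g : Fin m → ℕ) (ks : Vec (Fin m) n) → vsum (map (λ k → f k + g k) ks) ≡ vsum (map f ks) + vsum (map g ks)
  vsum-map-+ f g []       = refl
  vsum-map-+ f g (k ∷ ks) = trans (cong (f k + g k +_) (vsum-map-+ f g ks)) (interchange (f k) (g k) _ _)
    where
    interchange : ∀ a b c d → a + b + (c + d) ≡ a + c + (b + d)
    interchange = solve-∀

  -- Moving every letter one place up adds the total count to the weight:
  -- weight (x ∷ rs) = x + Σ rs + weight rs.
  weight-∷ : {m : ℕ} (x : ℕ) (rs : Vec ℕ m) → weight (x ∷ rs) ≡ (x + 0) + (vsum rs + weight rs)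
  weight-∷ {m} x rs = trans (cong vsum (map-allFin-suc (λ k → suc (toℕ k) * lookup (x ∷ rs) k)))
    (cong ((x + 0) +_) (trans (vsum-map-+ (lookup rs) (λ k → suc (toℕ k) * lookup rs k) (allFin m))
      (cong (_+ weight rs) (cong vsum (VecP.map-lookup-allFin rs)))))

  module _ {m : ℕ} where
    zeroCount≡listStat : (v : List (Fin (suc m))) → zeroCount v ≡ listStat (indicator 0) (List.map toℕ v)
    zeroCount≡listStat []          = refl
    zeroCount≡listStat (zero ∷ v)  = cong suc (zeroCount≡listStat v)
    zeroCount≡listStat (suc y ∷ v) = zeroCount≡listStat v

    listStat-lowerNonzero : ∀ a (v : List (Fin (suc m))) →
      listStat (indicator (suc a)) (List.map toℕ v) ≡ listStat (indicator a) (List.map toℕ (lowerNonzero v))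
    listStat-lowerNonzero a []          = refl
    listStat-lowerNonzero a (zero ∷ v)  = listStat-lowerNonzero a v
    listStat-lowerNonzero a (suc y ∷ v) = cong (indicator a (toℕ y) +_) (listStat-lowerNonzero a v)

    listStat-suc-split : (v : List (Fin (suc m))) →
      listStat suc (List.map toℕ v) ≡ length v + listStat suc (List.map toℕ (lowerNonzero v))
    listStat-suc-split []          = refl
    listStat-suc-split (zero ∷ v)  = cong suc (listStat-suc-split v)
    listStat-suc-split (suc y ∷ v) = trans (cong (suc (suc (toℕ y)) +_) (listStat-suc-split v)) (regroup (toℕ y) (length v) _)
      where
      regroup : ∀ y a b → suc (suc y) + (a + b) ≡ suc a + (suc y + b)
      regroup = solve-∀

  content≡multiplicities : {m : ℕ} (v : List (Fin m)) → content v ≡ multiplicities m (List.map toℕ v)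
  content≡multiplicities {zero}  v = refl
  content≡multiplicities {suc m} v = sym (begin
    multiplicities (suc m) (List.map toℕ v)
      ≡⟨ map-allFin-suc (λ k → listStat (indicator (toℕ k)) (List.map toℕ v)) ⟩
    listStat (indicator 0) (List.map toℕ v) ∷ map (λ k → listStat (indicator (suc (toℕ k))) (List.map toℕ v)) (allFin m)
      ≡⟨ cong₂ _∷_ (sym (zeroCount≡listStat v)) (VecP.map-cong (λ k → listStat-lowerNonzero (toℕ k) v) (allFin m)) ⟩
    zeroCount v ∷ multiplicities m (List.map toℕ (lowerNonzero v))
      ≡⟨ cong (zeroCount v ∷_) (sym (content≡multiplicities (lowerNonzero v))) ⟩
    content v ∎)
    where open ≡-Reasoning

  listStat-suc≡weight : {m : ℕ} (v : List (Fin m)) → listStat suc (List.map toℕ v) ≡ weight (content v)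
  listStat-suc≡weight {zero}  []      = refl
  listStat-suc≡weight {suc m} v       = begin
    listStat suc (List.map toℕ v)
      ≡⟨ listStat-suc-split v ⟩
    length v + listStat suc (List.map toℕ (lowerNonzero v))
      ≡⟨ cong₂ _+_ (trans (length-split v) (cong (zeroCount v +_) (length-content (lowerNonzero v)))) (listStat-suc≡weight (lowerNonzero v)) ⟩
    zeroCount v + vsum u + weight u
      ≡⟨ regroup (zeroCount v) (vsum u) (weight u) ⟩
    (zeroCount v + 0) + (vsum u + weight u)
      ≡⟨ weight-∷ (zeroCount v) u ⟨
    weight (content v) ∎
    where
    open ≡-Reasoning
    u = content (lowerNonzero v)
    regroup : ∀ a b c → a + b + c ≡ (a + 0) + (b + c)
    regroup = solve-∀

  toLetters : {m : ℕ} (w : List ℕ) → listStat suc w ≤ m → List (Fin m)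
  toLetters []      _ = []
  toLetters (x ∷ w) h = fromℕ< (ℕP.≤-trans (ℕP.m≤m+n (suc x) _) h) ∷ toLetters w (ℕP.≤-trans (ℕP.m≤n+m _ (suc x)) h)

  toℕ-toLetters : {m : ℕ} (w : List ℕ) (h : listStat suc w ≤ m) → List.map toℕ (toLetters w h) ≡ w
  toℕ-toLetters []      h = refl
  toℕ-toLetters (x ∷ w) h = cong₂ _∷_ (FinP.toℕ-fromℕ< _) (toℕ-toLetters w _)

  toLetters-toℕ : {m : ℕ} (v : List (Fin m)) (h : listStat suc (List.map toℕ v) ≤ m) → toLetters (List.map toℕ v) h ≡ v
  toLetters-toℕ []      h = refl
  toLetters-toℕ (y ∷ v) h = cong₂ _∷_ (FinP.fromℕ<-toℕ y _) (toLetters-toℕ v _)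

  Encoded↔Composition×Word : {p j m r : ℕ} (rs : Vec ℕ m) → vsum rs ≡ r → weight rs ≡ m →
    Σ (Vec (Fin (suc j)) p × List ℕ) (Encoded m r rs) ↔ (BoundedCompositions.Composition j p r × WordsWithContent rs)
  Encoded↔Composition×Word {p} {j} {m} {r} rs total weighted =
    Σ-↔-restrict (λ (ks , w) (_ , sum≡m , _) → ks , toLetters w (ℕP.≤-reflexive sum≡m)) (λ (ks , v) → ks , List.map toℕ v)
      letters-valid numbers-valid
      (λ (ks , w) _ → cong (ks ,_) (toℕ-toLetters w _))
      (λ (ks , v) _ → cong (ks ,_) (toLetters-toℕ v _))
      (×-irrelevant ℕP.≡-irrelevant (×-irrelevant ℕP.≡-irrelevant (×-irrelevant ℕP.≡-irrelevant ≡Vec-irrelevant)))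
      (×-irrelevant ℕP.≡-irrelevant ≡Vec-irrelevant)
    ⟫ Σ-×-split
    where
    Valid : Vec (Fin (suc j)) p × List (Fin m) → Set
    Valid (ks , v) = BoundedCompositions.partSum j ks ≡ r × content v ≡ rs

    letters-valid : ∀ kw (e : Encoded m r rs kw) → Valid (proj₁ kw , toLetters (proj₂ kw) (ℕP.≤-reflexive (proj₁ (proj₂ e))))
    letters-valid (ks , w) (e , sum≡m , len≡r , mult≡rs) =
      trans e len≡r ,
      trans (content≡multiplicities (toLetters w _)) (trans (cong (multiplicities m) (toℕ-toLetters w _)) mult≡rs)

    numbers-valid : ∀ kv → Valid kv → Encoded m r rs (proj₁ kv , List.map toℕ (proj₂ kv))
    numbers-valid (ks , v) (e , content≡rs) =
      trans e (sym length≡r) ,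
      trans (listStat-suc≡weight v) (trans (cong weight content≡rs) weighted) ,
      length≡r ,
      trans (sym (content≡multiplicities v)) content≡rs
      where
      length≡r : length (List.map toℕ v) ≡ r
      length≡r = trans (ListP.length-map toℕ v) (trans (length-content v) (trans (cong vsum content≡rs) total))


open import Data.Nat using (ℕ; suc; _≤_; _*_; s≤s; z≤n)
open import Data.Bool using (T)
open import Data.Vec using (Vec; map; allFin; lookup)
open import Data.Fin using (Fin; toℕ)
open import Data.Product using (Σ; ∃; _×_; _,_)
open import Data.Integer using (+_) renaming (_*_ to _*ℤ_)
import Data.Integer.Properties as ℤP
open import Data.Product.Function.NonDependent.Propositional using (_×-↔_)
open import Function.Bundles using (_↔_)
open import Relation.Binary.PropositionalEquality
open Bijections using (_⟫_; ×↔Fin*)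
open WordCounting using (wordCount; WordsWithContent↔Fin; multinomial≡wordCount)
open MatrixEncoding using (Counted; Counted↔Encoded)
open LetterEncoding using (Encoded↔Composition×Word)

corollary4p4 : (m j r p : ℕ) → 1 ≤ p → (rs : Vec ℕ m) →
  vsum rs ≡ r →
  vsum (map (λ k → suc (toℕ k) * lookup rs k) (allFin m)) ≡ m →
  ∃ λ (N : ℕ) →
    (Σ (Matrix p j) (λ B → T (isBMC m B) × nonzeroCount B ≡ r × entryTypes m B ≡ rs) ↔ Fin N)
    × (+ N ≡ (+ multinomial r rs) *ℤ altSum p j r)
corollary4p4 m j r p@(suc q) (s≤s z≤n) rs total weighted = N , counting , formula
  where
  open BoundedCompositions j using (compositions; Composition↔Fin; compositions≡altSum)
  N : ℕ
  N = compositions p r * wordCount rs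

  counting : Σ (Matrix p j) (Counted m r rs) ↔ Fin N
  counting = Counted↔Encoded ⟫ Encoded↔Composition×Word rs total weighted
    ⟫ (Composition↔Fin p r ×-↔ WordsWithContent↔Fin rs) ⟫ ×↔Fin*

  formula : + N ≡ (+ multinomial r rs) *ℤ altSum p j r
  formula = begin
    + (compositions p r * wordCount rs)              ≡⟨ ℤP.pos-* (compositions p r) (wordCount rs) ⟩
    + compositions p r *ℤ + wordCount rs             ≡⟨ ℤP.*-comm (+ compositions p r) (+ wordCount rs) ⟩
    + wordCount rs *ℤ + compositions p r             ≡⟨ cong₂ _*ℤ_ (cong +_ multinomial-r) (compositions≡altSum q r) ⟩
    + multinomial r rs *ℤ altSum p j r               ∎
    where
    open ≡-Reasoning
    multinomial-r : wordCount rs ≡ multinomial r rs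
    multinomial-r = trans (sym (multinomial≡wordCount rs)) (cong (λ t → multinomial t rs) total)
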